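{- Let $\mathcal{G}=\langle \mathit{Init},\mathit{Safe},\mathit{Reach},\mathit{Goal}\rangle$ be a reachability game, let $I=\mathit{Init}\land\neg\mathit{Goal}$, let $\varphi$ be a Craig interpolant for $I$ and $\mathit{Goal}$ (i.e., $\mathit{Goal}\Rightarrow\varphi$ valid, $I\land\varphi$ unsatisfiable, $\varphi$ over variables shared by $I$ and $\mathit{Goal}$), let $C=\operatorname{Instantiate}(\varphi,\mathcal{G})$, and let $$\mathcal{G}_{post}=\langle \operatorname{Post}(C)[\mathcal{V}'/\mathcal{V}],\ \mathit{Safe}\land\varphi,\ \mathit{Reach}\land\varphi,\ \mathit{Goal}\rangle.$$ Assume that $\varphi$ perfectly partitions $\mathcal{G}$, i.e., $(\mathit{Reach}\lor\mathit{Safe})\land\varphi\land\neg\varphi[\mathcal{V}/\mathcal{V}']\land\neg\mathit{Goal}$ is unsatisfiable. Let $s$ be a state satisfying $\operatorname{Post}(C)[\mathcal{V}'/\mathcal{V}]$. Then REACH wins from $s$ in $\mathcal{G}_{post}$ if and only if REACH wins from $s$ in $\mathcal{G}$.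
   Context: Fix a logic $\mathcal{L}$ and a finite set of variables $\mathcal{V}$ with domains, primed copies $\mathcal{V}'$, and a Boolean variable $\mathbf{r}\in\mathcal{V}$; $\varphi[\mathcal{V}/\mathcal{V}']$ primes all variables and $\varphi[\mathcal{V}'/\mathcal{V}]$ unprimes them. A state is a valuation of $\mathcal{V}$ respecting domains; $S$ the states, $S_{\mathrm{REACH}}=\{s:s(\mathbf{r})=\mathrm{true}\}$, $S_{\mathrm{SAFE}}=S\setminus S_{\mathrm{REACH}}$; $\varphi(s)$, $\tau(s,s')$ denote evaluation, $\tau(s)$ substitutes only unprimed variables. A reachability game $\langle \mathit{Init},\mathit{Safe},\mathit{Reach},\mathit{Goal}\rangle$ has state predicates $\mathit{Init},\mathit{Goal}$ and transition predicates $\mathit{Safe},\mathit{Reach}$ with $\mathit{Safe}\Rightarrow\neg\mathbf{r}$, $\mathit{Reach}\Rightarrow\mathbf{r}$ valid. A trap state is $s$ with $(\mathit{Safe}\lor\mathit{Reach})(s)$ unsatisfiable. A play from $s_0$ is a finite or infinite sequence $s_0s_1\ldots$ with $\mathit{Safe}(s_i,s_{i+1})$ or $\mathit{Reach}(s_i,s_{i+1})$ for consecutive pairs, ending in a trap state if finite. REACH wins a play if some state on it satisfies $\mathit{Goal}$; else SAFE wins. A reachability strategy is $\sigma_R:S^*S_{\mathrm{REACH}}\to S$ with $\mathit{Reach}(s,\sigma_R(ws))$ whenever $s$ is not a trap; safety strategies analogously. A strategy is winning from $s$ if its owner wins every play from $s$ consistent with it; a player wins from $s$ if they have such a strategy.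 All notions are relative to the game considered. $\operatorname{Post}(T)=\exists\mathcal{V}.T$; $\operatorname{Instantiate}(\varphi,\mathcal{G})=(\mathit{Safe}\lor\mathit{Reach})\land\neg\varphi\land\varphi[\mathcal{V}/\mathcal{V}']$. -}

module Defs where

open import Data.Bool using (Bool; true; false)
open import Data.Nat using (ℕ; zero; suc; _≤_; _<_)
open import Data.List using (List; map; upTo)
open import Data.Product using (Σ; _×_; _,_; ∃; proj₁)
open import Data.Sum using (_⊎_; inj₁; inj₂)
open import Data.Unit using (⊤)
open import Relation.Nullary using (¬_)
open import Relation.Binary.PropositionalEquality using (_≡_)

-- States: an abstract type S of valuations of 𝒱, together with the value of
-- the distinguished Boolean variable r in each state.
-- State predicates are S → Set, transition predicates S → S → Set
-- (first argument = unprimed state s, second = primed state s').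

record Game (S : Set) (r : S → Bool) : Set₁ where
  field
    Init  : S → Set
    Safe  : S → S → Set
    Reach : S → S → Set
    Goal  : S → Set
    safe⇒¬r  : ∀ s s' → Safe s s' → r s ≡ false
    reach⇒r  : ∀ s s' → Reach s s' → r s ≡ true

module _ {S : Set} {r : S → Bool} (G : Game S r) where
  open Game G

  Trans : S → S → Set
  Trans s s' = Safe s s' ⊎ Reach s s'

  Trap : S → Set
  Trap s = ¬ (Σ S λ s' → Trans s s')

  -- Length of a play: finite with last index n, or infinite
  data Length : Set where
    fin : ℕ → Length
    inf : Length

  OnPlay : Length → ℕ → Set
  OnPlay (fin n) i = i ≤ n
  OnPlay inf     i = ⊤

  HasNext : Length → ℕ → Set
  HasNext (fin n) i = i < n
  HasNext inf     i = ⊤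

  record Play (s₀ : S) : Set where
    field
      len   : Length
      st    : ℕ → S
      start : st 0 ≡ s₀
      step  : ∀ i → HasNext len i → Trans (st i) (st (suc i))
      ends  : ∀ n → len ≡ fin n → Trap (st n)

  -- Reachability strategy σ_R : S* S_REACH → S; the history w is the list of
  -- earlier states, s the current one (with r s = true).
  ReachStrategy : Set
  ReachStrategy =
    Σ (List S → (s : S) → r s ≡ true → S) λ σ →
      ∀ w s (rs : r s ≡ true) → ¬ Trap s → Reach s (σ w s rs)

  history : ∀ {s₀} → Play s₀ → ℕ → List S
  history p i = map (Play.st p) (upTo i)

  Consistent : ∀ {s₀} → ReachStrategy → Play s₀ → Set
  Consistent (σ , _) p =
    ∀ i → HasNext (Play.len p) i → (rs : r (Play.st p i) ≡ true) →
      Play.st p (suc i) ≡ σ (history p i) (Play.st p i) rs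

  ReachWinsPlay : ∀ {s₀} → Play s₀ → Set
  ReachWinsPlay p = ∃ λ i → OnPlay (Play.len p) i × Goal (Play.st p i)

  WinningFrom : ReachStrategy → S → Set
  WinningFrom σ s = (p : Play s) → Consistent σ p → ReachWinsPlay p

  ReachWins : S → Set
  ReachWins s = Σ ReachStrategy λ σ → WinningFrom σ s

  Instantiate : (S → Set) → S → S → Set
  Instantiate φ s s' = Trans s s' × ¬ φ s × φ s'

  -- Post(T)[𝒱'/𝒱] as a state predicate: (∃𝒱. T) with primes removed
  PostUnprimed : (S → S → Set) → S → Set
  PostUnprimed T t = Σ S λ s → T s t

  I : S → Set
  I s = Init s × ¬ Goal s

  -- φ is a Craig interpolant for I and Goal (semantic conditions)
  Interpolant : (S → Set) → Set
  Interpolant φ = (∀ s → Goal s → φ s) × (∀ s → ¬ (I s × φ s))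

  PerfectlyPartitions : (S → Set) → Set
  PerfectlyPartitions φ =
    ∀ s s' → ¬ ((Reach s s' ⊎ Safe s s') × φ s × ¬ φ s' × ¬ Goal s)

  Gpost : (S → Set) → Game S r
  Gpost φ = record
    { Init = PostUnprimed (Instantiate φ)
    ; Safe = λ s s' → Safe s s' × φ s
    ; Reach = λ s s' → Reach s s' × φ s
    ; Goal = Goal
    ; safe⇒¬r = λ s s' x → safe⇒¬r s s' (proj₁ x)
    ; reach⇒r = λ s s' x → reach⇒r s s' (proj₁ x)
    }

module Submission where

open import Defs
open import Data.Bool using (Bool; true)
open import Level using (0ℓ)
open import Axiom.ExcludedMiddle using (ExcludedMiddle)
open import Axiom.DoubleNegationElimination using (em⇒dne)
open import Function.Base using (id; _∘_)
open import Function.Bundles using (_⇔_; mk⇔)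
open import Data.Nat using (ℕ; suc)
open import Data.Nat.Properties using (≤-refl; <⇒≤)
open import Data.Product using (Σ; _,_; proj₁; proj₂)
open import Data.Sum using (_⊎_; inj₁; inj₂; [_,_])
open import Data.Unit using (tt)
open import Data.Empty using (⊥-elim)
open import Data.List using (List)
open import Relation.Nullary using (¬_; yes; no)
open import Relation.Binary.PropositionalEquality using (_≡_; refl; sym; trans)

-- Perfect partitioning makes φ invariant along any play from a φ-state that
-- has not yet met Goal: a step leaving φ would have to start at a non-goal
-- φ-state. On φ-states Gpost offers exactly the moves of G, so a play that
-- never meets Goal is a play of both games, and a winning strategy of either
-- game, restricted to φ or extended arbitrarily outside it, wins the other.

module _ {S : Set} {r : S → Bool} where

  private
    variable
      H H₁ H₂ : Game S r

  castLength : Length H₁ → Length H₂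
  castLength (fin n) = fin n
  castLength inf     = inf

  onPlay-castLength : (l : Length H₁) {i : ℕ} →
    OnPlay H₂ (castLength l) i → OnPlay H₁ l i
  onPlay-castLength (fin n) le = le
  onPlay-castLength inf     _  = tt

  hasNext-castLength : (l : Length H₁) {i : ℕ} →
    HasNext H₂ (castLength l) i → HasNext H₁ l i
  hasNext-castLength (fin n) lt = lt
  hasNext-castLength inf     _  = tt

  castLength-fin : (l : Length H₁) {n : ℕ} →
    castLength {H₂ = H₂} l ≡ fin n → l ≡ fin n
  castLength-fin (fin n) refl = refl

  hasNext⇒onPlay : (l : Length H) {i : ℕ} → HasNext H l i → OnPlay H l i
  hasNext⇒onPlay (fin n) lt = <⇒≤ lt
  hasNext⇒onPlay inf     _  = tt

  onPlay-suc⇒hasNext : (l : Length H) {i : ℕ} → OnPlay H l (suc i) → HasNext H l i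
  onPlay-suc⇒hasNext (fin n) le = le
  onPlay-suc⇒hasNext inf     _  = tt

  fin⇒onPlay : (l : Length H) {n : ℕ} → l ≡ fin n → OnPlay H l n
  fin⇒onPlay (fin n) refl = ≤-refl

  trans⇒reach : ∀ {x y} → r x ≡ true → Trans H x y → Game.Reach H x y
  trans⇒reach {H = H} rx (inj₁ safe) with () ← trans (sym rx) (Game.safe⇒¬r H _ _ safe)
  trans⇒reach         rx (inj₂ reach) = reach

  module _ (P : S → Set)
    (trans-lift : ∀ {x y} → P x → Trans H₁ x y → Trans H₂ x y)
    (trap-lift  : ∀ {x} → P x → Trap H₁ x → Trap H₂ x) where

    liftPlay : ∀ {s₀} (p : Play H₁ s₀) →
      (∀ i → OnPlay H₁ (Play.len p) i → P (Play.st p i)) → Play H₂ s₀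
    liftPlay p inP = record
      { len   = castLength len
      ; st    = st
      ; start = start
      ; step  = λ i hn → let hn₁ = hasNext-castLength len hn in
          trans-lift (inP i (hasNext⇒onPlay len hn₁)) (step i hn₁)
      ; ends  = λ n eq → let eq₁ = castLength-fin len eq in
          trap-lift (inP n (fin⇒onPlay len eq₁)) (ends n eq₁)
      }
      where open Play p

    winningFrom-transport : ∀ {s₀} (σ₁ : ReachStrategy H₁) (σ₂ : ReachStrategy H₂) →
      (∀ w x rx → P x → Σ S (Trans H₁ x) → proj₁ σ₁ w x rx ≡ proj₁ σ₂ w x rx) →
      (∀ x → Game.Goal H₂ x → Game.Goal H₁ x) →
      ((p : Play H₁ s₀) →
        ReachWinsPlay H₁ p ⊎ (∀ i → OnPlay H₁ (Play.len p) i → P (Play.st p i))) →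
      WinningFrom H₂ σ₂ s₀ → WinningFrom H₁ σ₁ s₀
    winningFrom-transport σ₁ σ₂ agree goal⇐ winsOrStays win₂ p consistent =
      [ id , winsAfterLifting ] (winsOrStays p)
      where
      open Play p
      winsAfterLifting : (∀ i → OnPlay H₁ len i → P (st i)) → ReachWinsPlay H₁ p
      winsAfterLifting inP =
        let i , onPlay , goal = win₂ (liftPlay p inP) consistent₂ in
        i , onPlay-castLength len onPlay , goal⇐ _ goal
        where
        consistent₂ : Consistent H₂ σ₂ (liftPlay p inP)
        consistent₂ i hn rs =
          let hn₁ = hasNext-castLength len hn in
          trans (consistent i hn₁ rs)
                (agree _ _ rs (inP i (hasNext⇒onPlay len hn₁)) (_ , step i hn₁))

  module _ (em : ExcludedMiddle 0ℓ) where

    reachWins-or-invariant : ∀ {φ : S → Set} → PerfectlyPartitions H φ →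
      ∀ {s₀} → φ s₀ → (p : Play H s₀) →
      ReachWinsPlay H p ⊎ (∀ i → OnPlay H (Play.len p) i → φ (Play.st p i))
    reachWins-or-invariant {H = H} {φ} pp φs₀ p with em {ReachWinsPlay H p}
    ... | yes wins = inj₁ wins
    ... | no ¬wins = inj₂ invariant
      where
      open Play p
      invariant : ∀ i → OnPlay H len i → φ (st i)
      invariant 0 _ rewrite start = φs₀
      invariant (suc i) onPlay = em⇒dne em λ ¬φ →
        pp (st i) (st (suc i)) ([ inj₂ , inj₁ ] (step i hn) , invariant i onPlay-i , ¬φ ,
            λ goal → ¬wins (i , onPlay-i , goal))
        where
        hn : HasNext H len i
        hn = onPlay-suc⇒hasNext len onPlay
        onPlay-i : OnPlay H len i
        onPlay-i = hasNext⇒onPlay len hn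

    someReachStrategy : (H : Game S r) → ReachStrategy H
    someReachStrategy H = move , move-valid
      where
      move : List S → (x : S) → r x ≡ true → S
      move _ x _ with em {Σ S (Game.Reach H x)}
      ... | yes (y , _) = y
      ... | no _        = x
      move-valid : ∀ w x (rx : r x ≡ true) → ¬ Trap H x → Game.Reach H x (move w x rx)
      move-valid _ x rx ¬trap with em {Σ S (Game.Reach H x)}
      ... | yes (_ , reach) = reach
      ... | no ¬reach = ⊥-elim (¬trap λ (y , t) → ¬reach (y , trans⇒reach {H = H} rx t))

    module _ (reach⊆ : ∀ {x y} → Game.Reach H₂ x y → Game.Reach H₁ x y)
      (σ₂ : ReachStrategy H₂) where

      extendStrategy : ReachStrategy H₁
      extendStrategy = move , move-valid
        where
        move : List S → (x : S) → r x ≡ true → S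
        move w x rx with em {Σ S (Trans H₂ x)}
        ... | yes _ = proj₁ σ₂ w x rx
        ... | no _  = proj₁ (someReachStrategy H₁) w x rx
        move-valid : ∀ w x (rx : r x ≡ true) → ¬ Trap H₁ x → Game.Reach H₁ x (move w x rx)
        move-valid w x rx ¬trap with em {Σ S (Trans H₂ x)}
        ... | yes t = reach⊆ (proj₂ σ₂ w x rx λ trap → trap t)
        ... | no _  = proj₂ (someReachStrategy H₁) w x rx ¬trap

      extendStrategy-agrees : ∀ w x rx → Σ S (Trans H₂ x) →
        proj₁ extendStrategy w x rx ≡ proj₁ σ₂ w x rx
      extendStrategy-agrees w x rx t with em {Σ S (Trans H₂ x)}
      ... | yes _ = refl
      ... | no ¬t = ⊥-elim (¬t t)

  module _ (G : Game S r) (φ : S → Set) where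

    private
      G' : Game S r
      G' = Gpost G φ

    post-trans⇒trans : ∀ {x y} → Trans G' x y → Trans G x y
    post-trans⇒trans (inj₁ (safe , _))  = inj₁ safe
    post-trans⇒trans (inj₂ (reach , _)) = inj₂ reach

    post-trans⇒φ : ∀ {x y} → Trans G' x y → φ x
    post-trans⇒φ (inj₁ (_ , φx)) = φx
    post-trans⇒φ (inj₂ (_ , φx)) = φx

    trans⇒post-trans : ∀ {x y} → φ x → Trans G x y → Trans G' x y
    trans⇒post-trans φx (inj₁ safe)  = inj₁ (safe , φx)
    trans⇒post-trans φx (inj₂ reach) = inj₂ (reach , φx)

    trap⇒post-trap : ∀ {x} → Trap G x → Trap G' x
    trap⇒post-trap trap (y , t) = trap (y , post-trans⇒trans t)

    post-trap⇒trap : ∀ {x} → φ x → Trap G' x → Trap G x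
    post-trap⇒trap φx trap (y , t) = trap (y , trans⇒post-trans φx t)

    perfectlyPartitions-post : PerfectlyPartitions G φ → PerfectlyPartitions G' φ
    perfectlyPartitions-post pp x y (t , φx , ¬φy , ¬goal) =
      pp x y ([ inj₁ ∘ proj₁ , inj₂ ∘ proj₁ ] t , φx , ¬φy , ¬goal)

    restrictStrategy : ExcludedMiddle 0ℓ → ReachStrategy G → ReachStrategy G'
    restrictStrategy em (move , move-valid) = move , move-valid′
      where
      move-valid′ : ∀ w x (rx : r x ≡ true) → ¬ Trap G' x → Game.Reach G' x (move w x rx)
      move-valid′ w x rx ¬trap = move-valid w x rx (¬trap ∘ trap⇒post-trap) , φx
        where
        φx : φ x
        φx = em⇒dne em λ ¬φ → ¬trap λ (_ , t) → ¬φ (post-trans⇒φ t)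

    extendPostStrategy : ExcludedMiddle 0ℓ → ReachStrategy G' → ReachStrategy G
    extendPostStrategy em = extendStrategy em {H₂ = G'} {H₁ = G} proj₁

    extendPostStrategy-agrees : (em : ExcludedMiddle 0ℓ) (σ' : ReachStrategy G') →
      ∀ w x rx → φ x → Σ S (Trans G x) →
      proj₁ (extendPostStrategy em σ') w x rx ≡ proj₁ σ' w x rx
    extendPostStrategy-agrees em σ' w x rx φx (y , t) =
      extendStrategy-agrees em proj₁ σ' w x rx (y , trans⇒post-trans φx t)

lemma6 : ExcludedMiddle 0ℓ →
    {S : Set} (r : S → Bool) (G : Game S r) (φ : S → Set) →
    Interpolant G φ →
    PerfectlyPartitions G φ →
    (s : S) → Game.Init (Gpost G φ) s →
    ReachWins (Gpost G φ) s ⇔ ReachWins G s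
lemma6 em {S} r G φ _ pp s (_ , _ , _ , φs) = mk⇔ post⇒G G⇒post
  where
  G' : Game S r
  G' = Gpost G φ

  post⇒G : ReachWins G' s → ReachWins G s
  post⇒G (σ' , win) = σ , winningFrom-transport φ
    (trans⇒post-trans G φ) (λ _ → trap⇒post-trap G φ) σ σ'
    (extendPostStrategy-agrees G φ em σ') (λ _ → id) (reachWins-or-invariant em pp φs) win
    where
    σ : ReachStrategy G
    σ = extendPostStrategy G φ em σ'

  G⇒post : ReachWins G s → ReachWins G' s
  G⇒post (σ , win) = σ' , winningFrom-transport φ
    (λ _ → post-trans⇒trans G φ) (post-trap⇒trap G φ) σ' σ
    (λ _ _ _ _ _ → refl) (λ _ → id)
    (reachWins-or-invariant em (perfectlyPartitions-post G φ pp) φs) win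
    where
    σ' : ReachStrategy G'
    σ' = restrictStrategy G φ em σ
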